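{- For every integer $n\geq 3$, the upper total domination number of the Cartesian product $C_4\Box C_n$ equals $2n$, i.e. $\Gamma_t(C_4\Box C_n)=2n$.
   Context: $C_m$ is the cycle on $m$ vertices and $\Box$ is the Cartesian product. For a graph $G$ without isolated vertices, a total dominating set (TD-set) is a set $S\subseteq V(G)$ such that every vertex of $G$ is adjacent to some vertex of $S$. A TD-set is minimal if no proper subset of it is a TD-set. The upper total domination number $\Gamma_t(G)$ is the maximum cardinality of a minimal TD-set of $G$. -}

module Defs where

open import Data.Nat using (ℕ; suc; _*_)
open import Data.Fin using (Fin; toℕ; remQuot)
open import Data.Fin.Subset using (Subset; _∈_; _⊂_; ∣_∣)
open import Data.Product using (Σ; ∃-syntax; _×_; _,_; proj₁; proj₂)
open import Relation.Binary.PropositionalEquality using (_≡_)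
open import Level using (0ℓ)
open import Relation.Binary using (Rel)
open import Data.Sum using () renaming (_⊎_ to _⊎'_)
open import Data.Empty using (⊥)
import Data.Nat

Graph : ℕ → Set₁
Graph N = Rel (Fin N) 0ℓ

-- Adjacency in the cycle C_m on vertices 0,…,m-1 : i ~ j iff j ≡ i+1 (mod m) or i ≡ j+1 (mod m).
-- (Intended for m ≥ 3, where this is the usual simple cycle.)
CycleAdj : (m : ℕ) → Fin m → Fin m → Set
CycleAdj m i j = (suc (toℕ i) ≡ toℕ j) ⊎' (suc (toℕ j) ≡ toℕ i)
                 ⊎' ((suc (toℕ i) ≡ m) × (toℕ j ≡ 0))
                 ⊎' ((suc (toℕ j) ≡ m) × (toℕ i ≡ 0))

-- Cartesian product C_m □ C_n with vertex set Fin (m * n) ≅ Fin m × Fin n (via remQuot):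
-- (a,b) ~ (c,d) iff (a ≡ c and b ~ d in C_n) or (b ≡ d and a ~ c in C_m).
CycleProd : (m n : ℕ) → Graph (m * n)
CycleProd m n u v with remQuot {m} n u | remQuot {m} n v
... | (a , b) | (c , d) = ((a ≡ c) × CycleAdj n b d) ⊎' ((b ≡ d) × CycleAdj m a c)

IsTDSet : {N : ℕ} → Graph N → Subset N → Set
IsTDSet {N} G S = (v : Fin N) → ∃[ u ] (u ∈ S × G v u)

IsMinimalTDSet : {N : ℕ} → Graph N → Subset N → Set
IsMinimalTDSet G S = IsTDSet G S × ((T : Subset _) → T ⊂ S → IsTDSet G T → ⊥)

UpperTotalDominationNumberIs : {N : ℕ} → Graph N → ℕ → Set
UpperTotalDominationNumberIs G k =
  (∃[ S ] (IsMinimalTDSet G S × ∣ S ∣ ≡ k)) ×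
  ((S : Subset _) → IsMinimalTDSet G S → ∣ S ∣ Data.Nat.≤ k)

-- Write a vertex of C₄ □ Cₙ as (row a, column b) and cut the vertex set into the n
-- staircases B_b = {(1,b), (3,b), (0,b+1), (2,b+1)}; every edge joins two consecutive
-- staircases, and |S| = Σ_b D_b where D_b = |S ∩ B_b|.  Let S be a minimal TD-set with
-- D_b ≥ 3 and let (a,b+1) ∈ S with a even.  At least two of the other three vertices of B_b
-- lie in S, and every neighbour of (a,b+1) except (a,b+2) is adjacent to two of those three,
-- so (a,b+2) is the private neighbour of (a,b+1).  Hence (1,b+2), (3,b+2) and (a,b+3) are
-- not in S, which gives D_b + D_{b+2} ≤ 4.  So D_b + min(D_{b+2}, 2) ≤ 2 + min(D_b, 2) for
-- every b, and summing over b yields |S| ≤ 2n.  The rows 0 and 1 form a minimal TD-set with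
-- 2n vertices.
module Submission where

open import Defs
open import Data.Nat using (ℕ; _≤_; _*_)

open import Data.Bool using (Bool; true; false; if_then_else_)
open import Data.Fin as Fin using (Fin; zero; suc; toℕ; fromℕ; inject₁; combine; remQuot; _↑ˡ_; _↑ʳ_)
open import Data.Fin.Patterns using (0F; 1F; 2F; 3F)
open import Data.Fin.Properties
  using (toℕ-injective; toℕ<n; toℕ-fromℕ; toℕ-inject₁; remQuot-combine; combine-surjective;
         combine-injectiveˡ; combine-injectiveʳ; any?; ¬∀⟶∃¬)
open import Data.Fin.Relation.Unary.Top using (view; ‵fromℕ; ‵inject₁; view-fromℕ; view-inject₁)
open import Data.Fin.Subset using (Subset; _∈_; _∉_; ∣_∣; _-_; inside; outside)
open import Data.Fin.Subset.Properties using (_∈?_; x∈p⇒p-x⊂p; x∈p∧x≢y⇒x∈p-y)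
open import Data.Nat as ℕ using (zero; suc; _+_; _⊓_; z≤n; s≤s; _≤?_)
open import Data.Nat.Properties
  using (+-0-commutativeMonoid; <⇒≢; <⇒≤; ≰⇒>; suc-injective; 1+n≢n; +-assoc; +-comm;
         +-mono-≤; +-monoʳ-≤; +-cancelʳ-≤; *-comm; ≤-trans; ≤-reflexive; ≤-pred;
         m≤n⇒m⊓n≡m; m≥n⇒m⊓n≡n; m⊓n≤m; m⊓n≤n; module ≤-Reasoning)
open import Data.Nat.Tactic.RingSolver using (solve-∀)
open import Data.Product using (∃; ∃-syntax; _×_; _,_; proj₁; proj₂)
open import Data.Sum using (_⊎_; inj₁; inj₂; [_,_])
open import Data.Vec using ([]; _∷_; lookup; tabulate)
open import Data.Vec.Properties using (lookup∘tabulate; []=⇒lookup; lookup⇒[]=)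
open import Function using (_∘_)
open import Relation.Binary using (Decidable)
open import Relation.Binary.PropositionalEquality
  using (_≡_; _≢_; refl; sym; trans; cong; cong₂; subst; subst₂; module ≡-Reasoning)
open import Relation.Nullary using (Dec; does; yes; no; ¬_; contradiction)
open import Relation.Nullary.Decidable using (_⊎-dec_; _×-dec_)

open import Algebra.Properties.CommutativeMonoid.Sum +-0-commutativeMonoid
  using (sum; sum-syntax; ∑-distrib-+; ∑-comm; sum-init-last; sum-cong-≗)

-- Cycles

next : ∀ {k} → Fin (suc k) → Fin (suc k)
next i with view i
... | ‵fromℕ     = zero
... | ‵inject₁ j = suc j

prev : ∀ {k} → Fin (suc k) → Fin (suc k)
prev zero    = fromℕ _
prev (suc j) = inject₁ j

next-fromℕ : ∀ k → next (fromℕ k) ≡ zero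
next-fromℕ k rewrite view-fromℕ k = refl

next-inject₁ : ∀ {k} (j : Fin k) → next (inject₁ j) ≡ suc j
next-inject₁ j rewrite view-inject₁ j = refl

prev-next : ∀ {k} (i : Fin (suc k)) → prev (next i) ≡ i
prev-next i with view i
... | ‵fromℕ     = refl
... | ‵inject₁ _ = refl

next-prev : ∀ {k} (i : Fin (suc k)) → next (prev i) ≡ i
next-prev zero    = next-fromℕ _
next-prev (suc j) = next-inject₁ j

CycleAdj-sym : ∀ {m} {i j : Fin m} → CycleAdj m i j → CycleAdj m j i
CycleAdj-sym (inj₁ p)               = inj₂ (inj₁ p)
CycleAdj-sym (inj₂ (inj₁ p))        = inj₁ p
CycleAdj-sym (inj₂ (inj₂ (inj₁ p))) = inj₂ (inj₂ (inj₂ p))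
CycleAdj-sym (inj₂ (inj₂ (inj₂ p))) = inj₂ (inj₂ (inj₁ p))

CycleAdj-next : ∀ {k} (i : Fin (suc k)) → CycleAdj (suc k) i (next i)
CycleAdj-next i with view i
... | ‵fromℕ     = inj₂ (inj₂ (inj₁ (cong suc (toℕ-fromℕ _) , refl)))
... | ‵inject₁ j = inj₁ (cong suc (toℕ-inject₁ j))

CycleAdj-prev : ∀ {k} (i : Fin (suc k)) → CycleAdj (suc k) i (prev i)
CycleAdj-prev i = CycleAdj-sym (subst (CycleAdj _ (prev i)) (next-prev i) (CycleAdj-next (prev i)))

next-unique : ∀ {k} {i j : Fin (suc k)} →
              (suc (toℕ i) ≡ toℕ j) ⊎ ((suc (toℕ i) ≡ suc k) × (toℕ j ≡ 0)) → j ≡ next i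
next-unique {k} {i} {j} h with view i | h
... | ‵fromℕ     | inj₁ p       = contradiction (trans (sym p) (cong suc (toℕ-fromℕ k))) (<⇒≢ (toℕ<n j))
... | ‵fromℕ     | inj₂ (_ , q) = toℕ-injective q
... | ‵inject₁ l | inj₁ p       = toℕ-injective (trans (sym p) (cong suc (toℕ-inject₁ l)))
... | ‵inject₁ l | inj₂ (q , _) =
  contradiction (trans (sym (toℕ-inject₁ l)) (suc-injective q)) (<⇒≢ (toℕ<n l))

prev-unique : ∀ {k} {i j : Fin (suc k)} → i ≡ next j → j ≡ prev i
prev-unique {j = j} refl = sym (prev-next j)

CycleAdj⇒next⊎prev : ∀ {k} {i j : Fin (suc k)} → CycleAdj (suc k) i j → j ≡ next i ⊎ j ≡ prev i
CycleAdj⇒next⊎prev (inj₁ p)               = inj₁ (next-unique (inj₁ p))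
CycleAdj⇒next⊎prev (inj₂ (inj₁ p))        = inj₂ (prev-unique (next-unique (inj₁ p)))
CycleAdj⇒next⊎prev (inj₂ (inj₂ (inj₁ p))) = inj₁ (next-unique (inj₂ p))
CycleAdj⇒next⊎prev (inj₂ (inj₂ (inj₂ p))) = inj₂ (prev-unique (next-unique (inj₂ p)))

next≢id : ∀ {k} → 1 ≤ k → (i : Fin (suc k)) → next i ≢ i
next≢id (s≤s z≤n) i e with view i | e
... | ‵fromℕ     | ()
... | ‵inject₁ j | e′ = 1+n≢n (trans (cong toℕ e′) (toℕ-inject₁ j))

prev≢id : ∀ {k} → 1 ≤ k → (i : Fin (suc k)) → prev i ≢ i
prev≢id 1≤k i e = next≢id 1≤k i (trans (cong next (sym e)) (next-prev i))

next≢prev : ∀ {k} → 2 ≤ k → (i : Fin (suc k)) → next i ≢ prev i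
next≢prev (s≤s (s≤s z≤n)) i e with view i | e
... | ‵fromℕ           | ()
... | ‵inject₁ zero    | ()
... | ‵inject₁ (suc j) | e′ = n≢2+n (begin
  toℕ j                       ≡⟨ toℕ-inject₁ j ⟨
  toℕ (inject₁ j)             ≡⟨ toℕ-inject₁ (inject₁ j) ⟨
  toℕ (inject₁ (inject₁ j))   ≡⟨ cong toℕ e′ ⟨
  suc (suc (toℕ j))           ∎)
  where
  open ≡-Reasoning
  n≢2+n : ∀ {n} → n ≢ suc (suc n)
  n≢2+n ()

next²≢id : ∀ {k} → 2 ≤ k → (i : Fin (suc k)) → next (next i) ≢ i
next²≢id 2≤k i e = next≢prev 2≤k i (trans (sym (prev-next (next i))) (cong prev e))

prev²≡next² : (a : Fin 4) → prev (prev a) ≡ next (next a)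
prev²≡next² 0F = refl
prev²≡next² 1F = refl
prev²≡next² 2F = refl
prev²≡next² 3F = refl

-- Counting with indicators

indicator : ∀ {a} {A : Set a} → Dec A → ℕ
indicator d = if does d then 1 else 0

indicator-yes : ∀ {a} {A : Set a} → A → (d : Dec A) → indicator d ≡ 1
indicator-yes a (yes _) = refl
indicator-yes a (no ¬a) = contradiction a ¬a

indicator-no : ∀ {a} {A : Set a} → ¬ A → (d : Dec A) → indicator d ≡ 0
indicator-no ¬a (yes a) = contradiction a ¬a
indicator-no ¬a (no _)  = refl

indicator≤1 : ∀ {a} {A : Set a} (d : Dec A) → indicator d ≤ 1
indicator≤1 (yes _) = s≤s z≤n
indicator≤1 (no _)  = z≤n

indicator-disjoint : ∀ {a b} {A : Set a} {B : Set b} (x : Dec A) (y : Dec B) →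
                     (A → ¬ B) → indicator x + indicator y ≤ 1
indicator-disjoint (yes a) (yes b) a⇒¬b = contradiction b (a⇒¬b a)
indicator-disjoint (yes _) (no _)  _    = s≤s z≤n
indicator-disjoint (no _)  y       _    = indicator≤1 y

indicator-some : ∀ {a b} {A : Set a} {B : Set b} (x : Dec A) (y : Dec B) →
                 1 ≤ indicator x + indicator y → A ⊎ B
indicator-some (yes a) _       _ = inj₁ a
indicator-some (no _)  (yes b) _ = inj₂ b
indicator-some (no _)  (no _)  ()

indicator-two-of-three : ∀ {a b c} {A : Set a} {B : Set b} {C : Set c} (x : Dec A) (y : Dec B) (z : Dec C) →
                         2 ≤ indicator x + (indicator y + indicator z) → (A ⊎ B) × (A ⊎ C) × (B ⊎ C)
indicator-two-of-three (yes a) (yes b) _       _ = inj₁ a , inj₁ a , inj₁ b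
indicator-two-of-three (yes a) (no _)  (yes c) _ = inj₁ a , inj₁ a , inj₂ c
indicator-two-of-three (no _)  (yes b) (yes c) _ = inj₂ b , inj₂ c , inj₁ b
indicator-two-of-three (yes _) (no _)  (no _)  (s≤s ())
indicator-two-of-three (no _)  (yes _) (no _)  (s≤s ())
indicator-two-of-three (no _)  (no _)  (yes _) (s≤s ())
indicator-two-of-three (no _)  (no _)  (no _)  ()

∣p∣≡∑indicator : ∀ {n} (p : Subset n) → ∣ p ∣ ≡ ∑[ i < n ] indicator (i ∈? p)
∣p∣≡∑indicator []            = refl
∣p∣≡∑indicator (inside  ∷ p) = cong suc (∣p∣≡∑indicator p)
∣p∣≡∑indicator (outside ∷ p) = ∣p∣≡∑indicator p

∑-mono-≤ : ∀ {n} {f g : Fin n → ℕ} → (∀ i → f i ≤ g i) → sum f ≤ sum g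
∑-mono-≤ {zero}  f≤g = z≤n
∑-mono-≤ {suc n} f≤g = +-mono-≤ (f≤g zero) (∑-mono-≤ (f≤g ∘ suc))

∑-const : ∀ n c → ∑[ i < n ] c ≡ n * c
∑-const zero    c = refl
∑-const (suc n) c = cong (c +_) (∑-const n c)

∑-split : ∀ m {n} (f : Fin (m + n) → ℕ) → sum f ≡ ∑[ i < m ] f (i ↑ˡ n) + ∑[ j < n ] f (m ↑ʳ j)
∑-split zero    f = refl
∑-split (suc m) f = trans (cong (f zero +_) (∑-split m (f ∘ suc))) (sym (+-assoc (f zero) _ _))

∑-combine : ∀ m {n} (f : Fin (m * n) → ℕ) → sum f ≡ ∑[ a < m ] ∑[ b < n ] f (combine a b)
∑-combine zero    f = refl
∑-combine (suc m) {n} f =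
  trans (∑-split n f) (cong (∑[ b < n ] f (combine {suc m} zero b) +_) (∑-combine m {n} (f ∘ (n ↑ʳ_))))

∑-next : ∀ {k} (f : Fin (suc k) → ℕ) → ∑[ i < suc k ] f (next i) ≡ sum f
∑-next {k} f = begin
  ∑[ i < suc k ] f (next i)                             ≡⟨ sum-init-last (f ∘ next) ⟩
  ∑[ j < k ] f (next (inject₁ j)) + f (next (fromℕ k))  ≡⟨ cong₂ _+_ (sum-cong-≗ (cong f ∘ next-inject₁))
                                                                     (cong f (next-fromℕ k)) ⟩
  ∑[ j < k ] f (suc j) + f zero                         ≡⟨ +-comm _ (f zero) ⟩
  sum f                                                 ∎
  where open ≡-Reasoning

∑-bounded-by-potential : ∀ {n} (f g : Fin n → ℕ) (σ : Fin n → Fin n) c →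
                         sum (g ∘ σ) ≡ sum g → (∀ i → f i + g (σ i) ≤ c + g i) → sum f ≤ n * c
∑-bounded-by-potential {n} f g σ c ∑gσ≡∑g step = +-cancelʳ-≤ (sum g) (sum f) (n * c) (begin
  sum f + sum g               ≡⟨ cong (sum f +_) ∑gσ≡∑g ⟨
  sum f + sum (g ∘ σ)         ≡⟨ ∑-distrib-+ f (g ∘ σ) ⟨
  ∑[ i < n ] (f i + g (σ i))  ≤⟨ ∑-mono-≤ step ⟩
  ∑[ i < n ] (c + g i)        ≡⟨ ∑-distrib-+ (λ _ → c) g ⟩
  ∑[ i < n ] c + sum g        ≡⟨ cong (_+ sum g) (∑-const n c) ⟩
  n * c + sum g               ∎)
  where open ≤-Reasoning

capped-potential-step : ∀ x y → (3 ≤ x → x + y ≤ 4) → x + y ⊓ 2 ≤ 2 + x ⊓ 2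
capped-potential-step x y heavy with x ≤? 2
... | yes x≤2 rewrite m≤n⇒m⊓n≡m x≤2 =
  ≤-trans (+-monoʳ-≤ x (m⊓n≤n y 2)) (≤-reflexive (+-comm x 2))
... | no  x≰2 rewrite m≥n⇒m⊓n≡n (<⇒≤ (≰⇒> x≰2)) =
  ≤-trans (+-monoʳ-≤ x (m⊓n≤m y 2)) (heavy (≰⇒> x≰2))

-- Private neighbours

record IsPrivateNeighbour {N} (G : Graph N) (S : Subset N) (v w : Fin N) : Set where
  constructor private-neighbour
  field
    adjacent : G w v
    unique   : ∀ {u} → u ∈ S → G w u → u ≡ v

  excludes : ∀ u → G w u → u ≢ v → u ∉ S
  excludes _ Gwu u≢v u∈S = u≢v (unique u∈S Gwu)

open IsPrivateNeighbour using (adjacent; excludes)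

minimal⇒private : ∀ {N} {G : Graph N} {S : Subset N} → Decidable G → IsMinimalTDSet G S →
                  ∀ {v} → v ∈ S → ∃ (IsPrivateNeighbour G S v)
minimal⇒private {N} {G} {S} G? (td , minimal) {v} v∈S = w , private-neighbour Gwv unique
  where
  dominated? : (w : Fin N) → Dec (∃[ u ] (u ∈ S - v × G w u))
  dominated? w = any? (λ u → (u ∈? S - v) ×-dec G? w u)

  undominated : ∃[ w ] ¬ (∃[ u ] (u ∈ S - v × G w u))
  undominated = ¬∀⟶∃¬ N _ dominated? (minimal (S - v) (x∈p⇒p-x⊂p v∈S))

  w : Fin N
  w = proj₁ undominated

  unique : ∀ {u} → u ∈ S → G w u → u ≡ v
  unique {u} u∈S Gwu with u Fin.≟ v
  ... | yes u≡v = u≡v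
  ... | no  u≢v = contradiction (u , x∈p∧x≢y⇒x∈p-y u∈S u≢v , Gwu) (proj₂ undominated)

  Gwv : G w v
  Gwv with td w
  ... | u , u∈S , Gwu = subst (G w) (unique u∈S Gwu) Gwu

private⇒minimal : ∀ {N} {G : Graph N} {S : Subset N} → IsTDSet G S →
                  (∀ {v} → v ∈ S → ∃ (IsPrivateNeighbour G S v)) → IsMinimalTDSet G S
private⇒minimal td pn = td , λ T (T⊆S , v , v∈S , v∉T) tdT →
  let w , private-neighbour _ unique = pn v∈S
      u , u∈T , Gwu = tdT w
  in  v∉T (subst (_∈ T) (unique (T⊆S u∈T) Gwu) u∈T)

-- The product C_m □ C_n in coordinates

CycleAdj? : ∀ m → Decidable (CycleAdj m)
CycleAdj? m i j =
  (suc (toℕ i) ℕ.≟ toℕ j) ⊎-dec (suc (toℕ j) ℕ.≟ toℕ i)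
  ⊎-dec ((suc (toℕ i) ℕ.≟ m) ×-dec (toℕ j ℕ.≟ 0))
  ⊎-dec ((suc (toℕ j) ℕ.≟ m) ×-dec (toℕ i ℕ.≟ 0))

module _ {m n : ℕ} where

  -- CycleProd m n u v unfolds definitionally to GridAdj (remQuot n u) (remQuot n v).
  GridAdj : Fin m × Fin n → Fin m × Fin n → Set
  GridAdj (a , b) (c , d) = ((a ≡ c) × CycleAdj n b d) ⊎ ((b ≡ d) × CycleAdj m a c)

  CycleProd? : Decidable (CycleProd m n)
  CycleProd? u v = GridAdj? (remQuot n u) (remQuot n v)
    where
    GridAdj? : Decidable GridAdj
    GridAdj? (a , b) (c , d) = ((a Fin.≟ c) ×-dec CycleAdj? n b d) ⊎-dec ((b Fin.≟ d) ×-dec CycleAdj? m a c)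

  CycleProd-sym : ∀ {u v} → CycleProd m n u v → CycleProd m n v u
  CycleProd-sym (inj₁ (a≡c , b~d)) = inj₁ (sym a≡c , CycleAdj-sym b~d)
  CycleProd-sym (inj₂ (b≡d , a~c)) = inj₂ (sym b≡d , CycleAdj-sym a~c)

  CycleProd-combine⁺ : ∀ {a c : Fin m} {b d : Fin n} →
                       GridAdj (a , b) (c , d) → CycleProd m n (combine a b) (combine c d)
  CycleProd-combine⁺ = subst₂ GridAdj (sym (remQuot-combine _ _)) (sym (remQuot-combine _ _))

  CycleProd-combine⁻ : ∀ {a c : Fin m} {b d : Fin n} →
                       CycleProd m n (combine a b) (combine c d) → GridAdj (a , b) (c , d)
  CycleProd-combine⁻ = subst₂ GridAdj (remQuot-combine _ _) (remQuot-combine _ _)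

  row-adj : ∀ {a c : Fin m} (b : Fin n) → CycleAdj m a c → CycleProd m n (combine a b) (combine c b)
  row-adj _ a~c = CycleProd-combine⁺ (inj₂ (refl , a~c))

  col-adj : ∀ (a : Fin m) {b d : Fin n} → CycleAdj n b d → CycleProd m n (combine a b) (combine a d)
  col-adj _ b~d = CycleProd-combine⁺ (inj₁ (refl , b~d))

  row-≢ : ∀ {a c : Fin m} {b d : Fin n} → c ≢ a → combine c d ≢ combine a b
  row-≢ c≢a = c≢a ∘ combine-injectiveˡ _ _ _ _

  col-≢ : ∀ (a : Fin m) {b d : Fin n} → d ≢ b → combine a d ≢ combine a b
  col-≢ a {b} {d} d≢b = d≢b ∘ combine-injectiveʳ a d a b

neighbours : ∀ {m n} {a : Fin (suc m)} {b : Fin (suc n)} w → CycleProd (suc m) (suc n) (combine a b) w →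
             w ≡ combine (next a) b ⊎ w ≡ combine (prev a) b ⊎
             w ≡ combine a (next b) ⊎ w ≡ combine a (prev b)
neighbours {m} {n} {a} {b} w adj with combine-surjective {suc m} {suc n} w
... | c , d , refl with CycleProd-combine⁻ {a = a} {c} {b} {d} adj
...   | inj₁ (refl , b~d) =
  [ inj₂ ∘ inj₂ ∘ inj₁ ∘ cong (combine a) , inj₂ ∘ inj₂ ∘ inj₂ ∘ cong (combine a) ]
    (CycleAdj⇒next⊎prev b~d)
...   | inj₂ (refl , a~c) =
  [ inj₁ ∘ cong (λ x → combine x b) , inj₂ ∘ inj₁ ∘ cong (λ x → combine x b) ]
    (CycleAdj⇒next⊎prev a~c)

-- Staircases of C₄ □ Cₙ

module Staircase {k : ℕ} (S : Subset (4 * suc k)) where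

  vertex : Fin 4 → Fin (suc k) → Fin (4 * suc k)
  vertex = combine

  occupied : Fin 4 → Fin (suc k) → ℕ
  occupied a b = indicator (vertex a b ∈? S)

  even odd : Fin (suc k) → ℕ
  even b = occupied 0F b + occupied 2F b
  odd  b = occupied 1F b + occupied 3F b

  staircase : Fin (suc k) → ℕ
  staircase b = even (next b) + odd b

  odd≤2 : ∀ b → odd b ≤ 2
  odd≤2 b = +-mono-≤ (indicator≤1 (vertex 1F b ∈? S)) (indicator≤1 (vertex 3F b ∈? S))

  ∣S∣≡∑staircase : ∣ S ∣ ≡ ∑[ b < suc k ] staircase b
  ∣S∣≡∑staircase = begin
    ∣ S ∣                                   ≡⟨ ∣p∣≡∑indicator S ⟩
    ∑[ i < 4 * suc k ] indicator (i ∈? S)   ≡⟨ ∑-combine 4 {suc k} (λ i → indicator (i ∈? S)) ⟩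
    ∑[ a < 4 ] ∑[ b < suc k ] occupied a b  ≡⟨ ∑-comm occupied ⟩
    ∑[ b < suc k ] ∑[ a < 4 ] occupied a b  ≡⟨ sum-cong-≗ (λ b → regroup (occupied 0F b) (occupied 1F b)
                                                                          (occupied 2F b) (occupied 3F b)) ⟩
    ∑[ b < suc k ] (even b + odd b)         ≡⟨ ∑-distrib-+ even odd ⟩
    sum even + sum odd                      ≡⟨ cong (_+ sum odd) (∑-next even) ⟨
    sum (even ∘ next) + sum odd             ≡⟨ ∑-distrib-+ (even ∘ next) odd ⟨
    ∑[ b < suc k ] staircase b              ∎
    where
    open ≡-Reasoning
    regroup : ∀ w x y z → w + (x + (y + (z + 0))) ≡ (w + y) + (x + z)
    regroup = solve-∀

module UpperBound {k : ℕ} (2≤k : 2 ≤ k) {S : Subset (4 * suc k)}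
                  (minimal : IsMinimalTDSet (CycleProd 4 (suc k)) S) where

  open Staircase S

  G : Graph (4 * suc k)
  G = CycleProd 4 (suc k)

  -- For even a, these are the other three vertices of the staircase through (a , next b).
  Crowded : Fin 4 → Fin (suc k) → Set
  Crowded a b = 2 ≤ occupied (next (next a)) (next b) + (occupied (next a) b + occupied (prev a) b)

  private-neighbour-ahead : ∀ a b → Crowded a b →
                            ∀ {w} → IsPrivateNeighbour G S (vertex a (next b)) w → w ≡ vertex a (next (next b))
  private-neighbour-ahead a b crowded {w} pn
    with indicator-two-of-three (vertex (next (next a)) (next b) ∈? S) (vertex (next a) b ∈? S)
                                (vertex (prev a) b ∈? S) crowded
       | neighbours {a = a} {b = next b} w (CycleProd-sym {u = w} {v = vertex a (next b)} (adjacent pn))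
  ... | A⊎B , _ , _ | inj₁ refl = contradiction A⊎B
    [ excludes pn (vertex (next (next a)) (next b)) (row-adj (next b) (CycleAdj-next (next a)))
                  (row-≢ (next²≢id (s≤s (s≤s z≤n)) a))
    , excludes pn (vertex (next a) b) (col-adj (next a) (CycleAdj-sym (CycleAdj-next b)))
                  (row-≢ (next≢id (s≤s z≤n) a)) ]
  ... | _ , A⊎C , _ | inj₂ (inj₁ refl) = contradiction A⊎C
    [ excludes pn (vertex (next (next a)) (next b))
                  (row-adj (next b) (subst (CycleAdj 4 (prev a)) (prev²≡next² a) (CycleAdj-prev (prev a))))
                  (row-≢ (next²≢id (s≤s (s≤s z≤n)) a))
    , excludes pn (vertex (prev a) b) (col-adj (prev a) (CycleAdj-sym (CycleAdj-next b)))
                  (row-≢ (prev≢id (s≤s z≤n) a)) ]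
  ... | _ , _ , _ | inj₂ (inj₂ (inj₁ refl)) = refl
  ... | _ , _ , B⊎C | inj₂ (inj₂ (inj₂ refl)) = contradiction B⊎C
    [ excludes pn (vertex (next a) b) (from-b {vertex (next a) b} (row-adj b (CycleAdj-next a)))
                  (row-≢ (next≢id (s≤s z≤n) a))
    , excludes pn (vertex (prev a) b) (from-b {vertex (prev a) b} (row-adj b (CycleAdj-prev a)))
                  (row-≢ (prev≢id (s≤s z≤n) a)) ]
    where
    from-b : ∀ {u} → G (vertex a b) u → G (vertex a (prev (next b))) u
    from-b {u} = subst (λ x → G (vertex a x) u) (sym (prev-next b))

  clears-ahead : ∀ a b → vertex a (next b) ∈ S → Crowded a b →
                 vertex (next a) (next (next b)) ∉ S × vertex (prev a) (next (next b)) ∉ S ×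
                 vertex a (next (next (next b))) ∉ S
  clears-ahead a b v∈S crowded = clear (proj₂ (minimal⇒private CycleProd? minimal v∈S))
    where
    clear : ∀ {w} → IsPrivateNeighbour G S (vertex a (next b)) w →
            vertex (next a) (next (next b)) ∉ S × vertex (prev a) (next (next b)) ∉ S ×
            vertex a (next (next (next b))) ∉ S
    clear pn with private-neighbour-ahead a b crowded pn
    ... | refl =
      excludes pn (vertex (next a) (next (next b))) (row-adj (next (next b)) (CycleAdj-next a))
                  (row-≢ (next≢id (s≤s z≤n) a)) ,
      excludes pn (vertex (prev a) (next (next b))) (row-adj (next (next b)) (CycleAdj-prev a))
                  (row-≢ (prev≢id (s≤s z≤n) a)) ,
      excludes pn (vertex a (next (next (next b)))) (col-adj a (CycleAdj-next (next (next b))))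
                  (col-≢ a (next²≢id 2≤k (next b)))

  heavy-staircase-bound : ∀ b → 3 ≤ staircase b → staircase b + staircase (next (next b)) ≤ 4
  heavy-staircase-bound b heavy = begin
    staircase b + staircase b₂                   ≡⟨ regroup x₀ x₂ (odd b) y₀ y₂ (odd b₂) ⟩
    (x₀ + y₀) + (x₂ + y₂) + odd b + odd b₂       ≤⟨ +-mono-≤ (+-mono-≤ (+-mono-≤ column₀ column₂) (odd≤2 b))
                                                             (≤-reflexive odd-ahead-empty) ⟩
    4                                            ∎
    where
    open ≤-Reasoning
    b₁ b₂ b₃ : Fin (suc k)
    b₁ = next b
    b₂ = next b₁
    b₃ = next b₂

    x₀ x₂ y₀ y₂ : ℕ
    x₀ = occupied 0F b₁
    x₂ = occupied 2F b₁
    y₀ = occupied 0F b₃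
    y₂ = occupied 2F b₃

    regroup : ∀ x₀ x₂ l y₀ y₂ l′ →
              (x₀ + x₂ + l) + (y₀ + y₂ + l′) ≡ (x₀ + y₀) + (x₂ + y₂) + l + l′
    regroup = solve-∀

    clears₀ : vertex 0F b₁ ∈ S → vertex 1F b₂ ∉ S × vertex 3F b₂ ∉ S × vertex 0F b₃ ∉ S
    clears₀ p = clears-ahead 0F b p
      (≤-pred (subst (λ x → 3 ≤ x + x₂ + odd b) (indicator-yes p (vertex 0F b₁ ∈? S)) heavy))

    clears₂ : vertex 2F b₁ ∈ S → vertex 3F b₂ ∉ S × vertex 1F b₂ ∉ S × vertex 2F b₃ ∉ S
    clears₂ p = clears-ahead 2F b p (≤-pred (subst (3 ≤_) x₂≡1 heavy))
      where
      swap : ∀ x y z → x + 1 + (y + z) ≡ suc (x + (z + y))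
      swap = solve-∀
      x₂≡1 : staircase b ≡ suc (x₀ + (occupied 3F b + occupied 1F b))
      x₂≡1 = trans (cong (λ x → x₀ + x + odd b) (indicator-yes p (vertex 2F b₁ ∈? S)))
                   (swap x₀ (occupied 1F b) (occupied 3F b))

    column₀ : x₀ + y₀ ≤ 1
    column₀ = indicator-disjoint (vertex 0F b₁ ∈? S) (vertex 0F b₃ ∈? S) (proj₂ ∘ proj₂ ∘ clears₀)

    column₂ : x₂ + y₂ ≤ 1
    column₂ = indicator-disjoint (vertex 2F b₁ ∈? S) (vertex 2F b₃ ∈? S) (proj₂ ∘ proj₂ ∘ clears₂)

    even-occupied : vertex 0F b₁ ∈ S ⊎ vertex 2F b₁ ∈ S
    even-occupied = indicator-some (vertex 0F b₁ ∈? S) (vertex 2F b₁ ∈? S)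
      (+-cancelʳ-≤ 2 1 (x₀ + x₂) (≤-trans heavy (+-monoʳ-≤ (x₀ + x₂) (odd≤2 b))))

    odd-ahead-empty : odd b₂ ≡ 0
    odd-ahead-empty with even-occupied
    ... | inj₁ p = let ¬1 , ¬3 , _ = clears₀ p in
      cong₂ _+_ (indicator-no ¬1 (vertex 1F b₂ ∈? S)) (indicator-no ¬3 (vertex 3F b₂ ∈? S))
    ... | inj₂ p = let ¬3 , ¬1 , _ = clears₂ p in
      cong₂ _+_ (indicator-no ¬1 (vertex 1F b₂ ∈? S)) (indicator-no ¬3 (vertex 3F b₂ ∈? S))

  ∣S∣≤2n : ∣ S ∣ ≤ 2 * suc k
  ∣S∣≤2n = begin
    ∣ S ∣          ≡⟨ ∣S∣≡∑staircase ⟩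
    sum staircase  ≤⟨ ∑-bounded-by-potential staircase potential (next ∘ next) 2
                        (trans (∑-next (potential ∘ next)) (∑-next potential))
                        (λ b → capped-potential-step (staircase b) _ (heavy-staircase-bound b)) ⟩
    suc k * 2      ≡⟨ *-comm (suc k) 2 ⟩
    2 * suc k      ∎
    where
    open ≤-Reasoning
    potential : Fin (suc k) → ℕ
    potential b = staircase b ⊓ 2

module LowerRows (k : ℕ) where

  G : Graph (4 * suc k)
  G = CycleProd 4 (suc k)

  low : Fin 4 → Bool
  low 0F = true
  low 1F = true
  low 2F = false
  low 3F = false

  lowerRows : Subset (4 * suc k)
  lowerRows = tabulate (low ∘ proj₁ ∘ remQuot (suc k))

  open Staircase lowerRows using (vertex; staircase; ∣S∣≡∑staircase)

  lookup-lowerRows : ∀ a b → lookup lowerRows (vertex a b) ≡ low a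
  lookup-lowerRows a b =
    trans (lookup∘tabulate (low ∘ proj₁ ∘ remQuot (suc k)) (vertex a b))
          (cong (low ∘ proj₁) (remQuot-combine a b))

  low⇒∈ : ∀ a b → low a ≡ true → vertex a b ∈ lowerRows
  low⇒∈ a b e = lookup⇒[]= (vertex a b) lowerRows (trans (lookup-lowerRows a b) e)

  ∈⇒low : ∀ {a b} → vertex a b ∈ lowerRows → low a ≡ true
  ∈⇒low {a} {b} x∈ = trans (sym (lookup-lowerRows a b)) ([]=⇒lookup x∈)

  high⇒∉ : ∀ a b → low a ≡ false → vertex a b ∉ lowerRows
  high⇒∉ a b e x∈ with trans (sym (∈⇒low x∈)) e
  ... | ()

  ∣lowerRows∣ : ∣ lowerRows ∣ ≡ 2 * suc k
  ∣lowerRows∣ = begin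
    ∣ lowerRows ∣               ≡⟨ ∣S∣≡∑staircase ⟩
    ∑[ b < suc k ] staircase b  ≡⟨ sum-cong-≗ staircase≡2 ⟩
    ∑[ b < suc k ] 2            ≡⟨ ∑-const (suc k) 2 ⟩
    suc k * 2                   ≡⟨ *-comm (suc k) 2 ⟩
    2 * suc k                   ∎
    where
    open ≡-Reasoning
    staircase≡2 : ∀ b → staircase b ≡ 2
    staircase≡2 b = cong₂ _+_
      (cong₂ _+_ (indicator-yes (low⇒∈ 0F (next b) refl) (vertex 0F (next b) ∈? lowerRows))
                 (indicator-no (high⇒∉ 2F (next b) refl) (vertex 2F (next b) ∈? lowerRows)))
      (cong₂ _+_ (indicator-yes (low⇒∈ 1F b refl) (vertex 1F b ∈? lowerRows))
                 (indicator-no (high⇒∉ 3F b refl) (vertex 3F b ∈? lowerRows)))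

  low-neighbour : ∀ a → ∃[ c ] (CycleAdj 4 a c × low c ≡ true)
  low-neighbour 0F = 1F , CycleAdj-next 0F , refl
  low-neighbour 1F = 0F , CycleAdj-prev 1F , refl
  low-neighbour 2F = 1F , CycleAdj-prev 2F , refl
  low-neighbour 3F = 0F , CycleAdj-next 3F , refl

  lowerRows-td : IsTDSet G lowerRows
  lowerRows-td v with combine-surjective {4} {suc k} v
  ... | a , b , refl with low-neighbour a
  ...   | c , a~c , low-c = vertex c b , low⇒∈ c b low-c , row-adj b a~c

  high-row-neighbours : ∀ h b → low h ≡ false → ∀ {u} → u ∈ lowerRows → G (vertex h b) u →
                        u ≡ vertex (next h) b ⊎ u ≡ vertex (prev h) b
  high-row-neighbours h b high {u} u∈ adj with neighbours {a = h} {b = b} u adj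
  ... | inj₁ e                  = inj₁ e
  ... | inj₂ (inj₁ e)           = inj₂ e
  ... | inj₂ (inj₂ (inj₁ refl)) = contradiction u∈ (high⇒∉ h (next b) high)
  ... | inj₂ (inj₂ (inj₂ refl)) = contradiction u∈ (high⇒∉ h (prev b) high)

  low-private-neighbour : ∀ a b → low a ≡ true → ∃ (IsPrivateNeighbour G lowerRows (vertex a b))
  low-private-neighbour 0F b _ = vertex 3F b , private-neighbour (row-adj b (CycleAdj-next 3F)) unique
    where
    unique : ∀ {u} → u ∈ lowerRows → G (vertex 3F b) u → u ≡ vertex 0F b
    unique u∈ adj with high-row-neighbours 3F b refl u∈ adj
    ... | inj₁ e    = e
    ... | inj₂ refl = contradiction u∈ (high⇒∉ 2F b refl)
  low-private-neighbour 1F b _ = vertex 2F b , private-neighbour (row-adj b (CycleAdj-prev 2F)) unique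
    where
    unique : ∀ {u} → u ∈ lowerRows → G (vertex 2F b) u → u ≡ vertex 1F b
    unique u∈ adj with high-row-neighbours 2F b refl u∈ adj
    ... | inj₁ refl = contradiction u∈ (high⇒∉ 3F b refl)
    ... | inj₂ e    = e
  low-private-neighbour 2F b ()
  low-private-neighbour 3F b ()

  lowerRows-minimal : IsMinimalTDSet G lowerRows
  lowerRows-minimal = private⇒minimal lowerRows-td private-neighbour-of
    where
    private-neighbour-of : ∀ {v} → v ∈ lowerRows → ∃ (IsPrivateNeighbour G lowerRows v)
    private-neighbour-of {v} v∈ with combine-surjective {4} {suc k} v
    ... | a , b , refl = low-private-neighbour a b (∈⇒low v∈)

theorem5p2 : (n : ℕ) → 3 ≤ n → UpperTotalDominationNumberIs (CycleProd 4 n) (2 * n)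
theorem5p2 (suc k) (s≤s 2≤k) =
  (lowerRows , lowerRows-minimal , ∣lowerRows∣) , λ S minimal → UpperBound.∣S∣≤2n 2≤k minimal
  where open LowerRows k
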